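{- Let $n\geq 1$, let $\Phi$ be a domain containing pairwise distinct variables $p_1,\dots,p_n,q_1,\dots,q_n$, and let $\vec p=(p_1,\dots,p_n)$, $\vec q=(q_1,\dots,q_n)$. Then $\mathrm{Dim}(=\!\!(\vec p;q_1))\geq 2^{2^n}$ and $\mathrm{Dim}(\vec p\mid\vec q)\geq 2^{2^n}-2$.
   Context: A $\Phi$-team is a set of maps $s:\Phi\to\{0,1\}$; $s(\vec p)$ is the tuple $(s(p_1),\dots,s(p_n))$. Atoms: $T\models\,=\!\!(\vec p;q)$ iff for all $s,s'\in T$, $s(\vec p)=s'(\vec p)$ implies $s(q)=s'(q)$; $T\models\vec p\mid\vec q$ iff $s(\vec p)\ne s'(\vec q)$ for all $s,s'\in T$. A generator of a formula $\varphi$ (over $\Phi$) is a set $\mathbb{G}$ of pairs $(S,U)$ of $\Phi$-teams with $S\subseteq U$ such that for every $\Phi$-team $T$: $T\models\varphi$ iff there is $(S,U)\in\mathbb{G}$ with $S\subseteq T\subseteq U$. The upper dimension of $\mathbb{G}$ is $\mathrm{Dim}(\mathbb{G})=|\{U:(S,U)\in\mathbb{G}\}|$; $\mathrm{Dim}(\varphi)$ is the minimum of $\mathrm{Dim}(\mathbb{G})$ over generators $\mathbb{G}$ of $\varphi$. -}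

module Defs where

open import Data.Nat using (ℕ)
open import Data.Bool using (Bool; true)
open import Data.Fin using (Fin)
open import Data.Product using (Σ; ∃; _×_)
open import Relation.Binary.PropositionalEquality using (_≡_)
open import Relation.Nullary using (¬_)
open import Level using (0ℓ; suc)

-- The domain Φ is the finite set of variables Fin m.
-- An assignment is a map s : Φ → {0,1}.
Assignment : ℕ → Set
Assignment m = Fin m → Bool

-- A Φ-team is a set of assignments, given by its characteristic function
-- (the assignment space is finite, so every set is of this form).
Team : ℕ → Set
Team m = Assignment m → Bool

_∈T_ : ∀ {m} → Assignment m → Team m → Set
s ∈T T = T s ≡ true

_⊆T_ : ∀ {m} → Team m → Team m → Set
S ⊆T T = ∀ s → s ∈T S → s ∈T T

_≐_ : ∀ {m} → Team m → Team m → Set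
T ≐ T' = ∀ s → T s ≡ T' s

-- a formula is identified with its team semantics (the class of teams satisfying it)
Formula : ℕ → Set₁
Formula m = Team m → Set

SameVals : ∀ {m n} → Assignment m → (Fin n → Fin m) → Assignment m → (Fin n → Fin m) → Set
SameVals s p s' q = ∀ i → s (p i) ≡ s' (q i)

Dep : ∀ {m n} → (Fin n → Fin m) → Fin m → Formula m
Dep p r T = ∀ s s' → s ∈T T → s' ∈T T → SameVals s p s' p → s r ≡ s' r

Excl : ∀ {m n} → (Fin n → Fin m) → (Fin n → Fin m) → Formula m
Excl p q T = ∀ s s' → s ∈T T → s' ∈T T → ¬ SameVals s p s' q

PairSet : ℕ → Set₁
PairSet m = Team m → Team m → Set

IsGenerator : ∀ {m} → Formula m → PairSet m → Set
IsGenerator {m} φ G =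
  (∀ S U → G S U → S ⊆T U) ×
  (∀ (T : Team m) →
     (φ T → Σ (Team m) λ S → Σ (Team m) λ U → G S U × S ⊆T T × T ⊆T U) ×
     ((Σ (Team m) λ S → Σ (Team m) λ U → G S U × S ⊆T T × T ⊆T U) → φ T))

-- Dim(𝔾) ≥ N : the set {U : (S,U) ∈ 𝔾} has at least N elements, i.e. there are
-- N pairwise distinct (as sets) teams each of which is such a U.
UpperDimAtLeast : ∀ {m} → PairSet m → ℕ → Set
UpperDimAtLeast {m} G N =
  Σ (Fin N → Team m) λ f →
    (∀ i → Σ (Team m) λ S → Σ (Team m) λ U → G S U × f i ≐ U) ×
    (∀ i j → f i ≐ f j → i ≡ j)

DimAtLeast : ∀ {m} → Formula m → ℕ → Set₁
DimAtLeast {m} φ N = ∀ (G : PairSet m) → IsGenerator φ G → UpperDimAtLeast G N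

{-# OPTIONS --safe #-}

-- If T is maximal among the teams satisfying φ, then T must itself be an upper
-- team U of every generator: some (S , U) covers T, and U satisfies φ (it is
-- covered by (S , U)), so maximality forces T = U.  Hence Dim φ is at least the
-- number of maximal teams of φ.  Every Boolean function h in n variables gives
-- the maximal team {s | s(q₁) = h(s(p⃗))} of =(p⃗;q₁), and, if h is not constant,
-- the maximal team {s | h(s(p⃗)) = 1, h(s(q⃗)) = 0} of p⃗ | q⃗; distinct h give
-- distinct teams.  There are 2^2^n Boolean functions, two of them constant.

module Submission where

open import Defs
open import Data.Nat using (ℕ; zero; suc; _^_; _∸_)
open import Data.Fin using (Fin; zero; suc; funToFin; finToFun; combine; punchIn; punchOut)
open import Data.Fin.Properties
  using (_≟_; any?; 2↔Bool; funToFin-finToFin; finToFun-funToFin; ¬∀⟶∃¬;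
         punchIn-injective; punchInᵢ≢i; punchIn-punchOut)
open import Data.Bool using (Bool; true; false; not)
open import Data.Bool.Properties using (¬-not) renaming (_≟_ to _≟𝔹_)
open import Data.Product using (Σ; ∃; _×_; _,_; proj₁; proj₂)
open import Data.Vec.Functional using (updateAt)
open import Data.Vec.Functional.Properties using (updateAt-updates; updateAt-minimal)
open import Function using (_∘_; const)
open import Function.Bundles using (Inverse)
open import Function.Definitions using (Injective; Congruent)
open import Relation.Binary.PropositionalEquality
  using (_≡_; _≢_; _≗_; refl; sym; trans; cong; cong₂; module ≡-Reasoning)
open import Relation.Nullary using (¬_; yes; no; does; contradiction; _×-dec_)
open import Relation.Nullary.Decidable using (dec-true)
open import Relation.Unary using (Pred; Decidable)
open import Level using (0ℓ)

open Inverse 2↔Bool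
  using (strictlyInverseˡ; strictlyInverseʳ) renaming (to to toBool; from to fromBool)

variable
  m n N : ℕ

⊆T-antisym : {A B : Team m} → A ⊆T B → B ⊆T A → A ≐ B
⊆T-antisym {A = A} {B} A⊆B B⊆A s with A s in eA | B s in eB
... | true  | true  = refl
... | false | false = refl
... | true  | false = sym (trans (sym eB) (A⊆B s eA))
... | false | true  = trans (sym eA) (B⊆A s eB)

IsMaximal : Formula m → Team m → Set
IsMaximal φ T = φ T × (∀ U → φ U → T ⊆T U → U ⊆T T)

maximal-isUpper : {φ : Formula m} {G : PairSet m} {T : Team m} →
                  IsGenerator φ G → IsMaximal φ T →
                  Σ (Team m) λ S → Σ (Team m) λ U → G S U × T ≐ U
maximal-isUpper {φ = φ} {G} {T} (S⊆U , generates) (φT , T-max)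
  with proj₁ (generates T) φT
... | S , U , SU∈G , S⊆T , T⊆U =
  S , U , SU∈G , ⊆T-antisym T⊆U (T-max U φU T⊆U)
  where
  φU : φ U
  φU = proj₂ (generates U) (S , U , SU∈G , S⊆U S U SU∈G , λ _ s∈U → s∈U)

maximal⇒DimAtLeast : {φ : Formula m} (F : Fin N → Team m) →
                     (∀ i → IsMaximal φ (F i)) → (∀ i j → F i ≐ F j → i ≡ j) →
                     DimAtLeast φ N
maximal⇒DimAtLeast F F-max F-distinct G G-gen =
  F , (λ i → maximal-isUpper G-gen (F-max i)) , F-distinct

team : {P : Pred (Assignment m) 0ℓ} → Decidable P → Team m
team P? s = does (P? s)

∈team⁺ : {P : Pred (Assignment m) 0ℓ} (P? : Decidable P) {s : Assignment m} →
         P s → s ∈T team P?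
∈team⁺ P? {s} = dec-true (P? s)

∈team⁻ : {P : Pred (Assignment m) 0ℓ} (P? : Decidable P) {s : Assignment m} →
         s ∈T team P? → P s
∈team⁻ P? {s} s∈ with P? s
... | yes Ps = Ps
... | no _   = contradiction s∈ λ ()

_[_↦_] : {k : ℕ} → Assignment m → (Fin k → Fin m) → (Fin k → Bool) → Assignment m
(s [ r ↦ u ]) x with any? (λ i → r i ≟ x)
... | yes (i , _) = u i
... | no _        = s x

module _ {k : ℕ} {r : Fin k → Fin m} (u : Fin k → Bool) (s : Assignment m) where

  ↦-on : Injective _≡_ _≡_ r → (s [ r ↦ u ]) ∘ r ≗ u
  ↦-on r-inj i with any? (λ j → r j ≟ r i)
  ... | yes (j , rj≡ri) = cong u (r-inj rj≡ri)
  ... | no ∄j           = contradiction (i , refl) ∄j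

  ↦-off : {x : Fin m} → (∀ i → r i ≢ x) → (s [ r ↦ u ]) x ≡ s x
  ↦-off {x} x∉r with any? (λ j → r j ≟ x)
  ... | yes (j , rj≡x) = contradiction rj≡x (x∉r j)
  ... | no _           = refl

funToFin-cong : {f g : Fin m → Fin n} → f ≗ g → funToFin f ≡ funToFin g
funToFin-cong {zero}  f≗g = refl
funToFin-cong {suc m} f≗g = cong₂ combine (f≗g zero) (funToFin-cong (f≗g ∘ suc))

encode : (Fin n → Bool) → Fin (2 ^ n)
encode {n} v = funToFin {n} (fromBool ∘ v)

decode : ∀ n → Fin (2 ^ n) → Fin n → Bool
decode n x = toBool ∘ finToFun {2} {n} x

encode-cong : {v w : Fin n → Bool} → v ≗ w → encode v ≡ encode w
encode-cong {n} v≗w = funToFin-cong {n} (cong fromBool ∘ v≗w)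

encode-decode : (x : Fin (2 ^ n)) → encode (decode n x) ≡ x
encode-decode {n} x =
  trans (funToFin-cong {n} (strictlyInverseʳ ∘ finToFun x)) (funToFin-finToFin {n} x)

decode-encode : (v : Fin n → Bool) → decode n (encode v) ≗ v
decode-encode {n} v j =
  trans (cong toBool (finToFun-funToFin {n} (fromBool ∘ v) j)) (strictlyInverseˡ (v j))

encode-injective : {v w : Fin n → Bool} → encode v ≡ encode w → v ≗ w
encode-injective {n} {v} {w} ev≡ew j = begin
  v j                   ≡⟨ decode-encode v j ⟨
  decode n (encode v) j ≡⟨ cong (λ x → decode n x j) ev≡ew ⟩
  decode n (encode w) j ≡⟨ decode-encode w j ⟩
  w j                   ∎
  where open ≡-Reasoning

encode-false≢encode-true : encode {2 ^ n} (const false) ≢ encode {2 ^ n} (const true)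
encode-false≢encode-true {n} e =
  contradiction (encode-injective {2 ^ n} e (encode {n} (const false))) λ ()

-- x is read as a truth table Fin (2 ^ n) → Bool, and a valuation of n variables
-- as an index into it, both via the library's Fin (m ^ n) ↔ (Fin n → Fin m).
boolFun : Fin (2 ^ 2 ^ n) → (Fin n → Bool) → Bool
boolFun {n} x = decode (2 ^ n) x ∘ encode

boolFun-cong : (x : Fin (2 ^ 2 ^ n)) → Congruent _≗_ _≡_ (boolFun {n} x)
boolFun-cong {n} x = cong (decode (2 ^ n) x) ∘ encode-cong

decode-via-boolFun : (x : Fin (2 ^ 2 ^ n)) → decode (2 ^ n) x ≗ boolFun x ∘ decode n
decode-via-boolFun {n} x j = cong (decode (2 ^ n) x) (sym (encode-decode {n} j))

boolFun-injective : {x y : Fin (2 ^ 2 ^ n)} →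
                    (∀ v → boolFun {n} x v ≡ boolFun y v) → x ≡ y
boolFun-injective {n} {x} {y} fx≗fy = begin
  x                          ≡⟨ encode-decode {2 ^ n} x ⟨
  encode (decode (2 ^ n) x)  ≡⟨ encode-cong decodes-agree ⟩
  encode (decode (2 ^ n) y)  ≡⟨ encode-decode {2 ^ n} y ⟩
  y                          ∎
  where
  open ≡-Reasoning
  decodes-agree : decode (2 ^ n) x ≗ decode (2 ^ n) y
  decodes-agree j = trans (decode-via-boolFun {n} x j)
                      (trans (fx≗fy (decode n j)) (sym (decode-via-boolFun {n} y j)))

boolFun-nonconstant : {x : Fin (2 ^ 2 ^ n)} (b : Bool) → x ≢ encode {2 ^ n} (const b) →
                      ∃ λ v → boolFun {n} x v ≡ not b
boolFun-nonconstant {n} {x} b x≢b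
  with ¬∀⟶∃¬ (2 ^ n) (λ j → decode (2 ^ n) x j ≡ b)
                     (λ j → decode (2 ^ n) x j ≟𝔹 b) not-constantly-b
  where
  not-constantly-b : ¬ (∀ j → decode (2 ^ n) x j ≡ b)
  not-constantly-b x≗b = x≢b (trans (sym (encode-decode {2 ^ n} x)) (encode-cong x≗b))
... | j , xj≢b = decode n j , trans (sym (decode-via-boolFun {n} x j)) (¬-not xj≢b)

avoid-two : {a b : Fin N} → a ≢ b →
            Σ (Fin (N ∸ 2) → Fin N) λ f →
              Injective _≡_ _≡_ f × (∀ i → f i ≢ a) × (∀ i → f i ≢ b)
avoid-two {suc zero}    {zero} {zero} a≢b = contradiction refl a≢b
avoid-two {suc (suc N)} {a}    {b}    a≢b = f , f-injective , f≢a , f≢b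
  where
  b⁻ : Fin (suc N)
  b⁻ = punchOut a≢b
  f : Fin N → Fin (suc (suc N))
  f = punchIn a ∘ punchIn b⁻
  f-injective : Injective _≡_ _≡_ f
  f-injective = punchIn-injective b⁻ _ _ ∘ punchIn-injective a _ _
  f≢a : ∀ i → f i ≢ a
  f≢a i = punchInᵢ≢i a (punchIn b⁻ i)
  f≢b : ∀ i → f i ≢ b
  f≢b i fi≡b =
    punchInᵢ≢i b⁻ i (punchIn-injective a _ _ (trans fi≡b (sym (punchIn-punchOut a≢b))))

dep? : (p : Fin n → Fin m) (r : Fin m) (h : (Fin n → Bool) → Bool) →
       Decidable (λ s → h (s ∘ p) ≡ s r)
dep? p r h s = h (s ∘ p) ≟𝔹 s r

depTeam : (Fin n → Fin m) → Fin m → ((Fin n → Bool) → Bool) → Team m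
depTeam p r h = team (dep? p r h)

module _ {p : Fin n → Fin m} {r : Fin m}
         (p-injective : Injective _≡_ _≡_ p) (r∉p : ∀ i → p i ≢ r) where

  extendDep : (Fin n → Bool) → Bool → Assignment m
  extendDep v b = updateAt (const false [ p ↦ v ]) r (const b)

  extendDep-p : (v : Fin n → Bool) (b : Bool) → extendDep v b ∘ p ≗ v
  extendDep-p v b i = trans (updateAt-minimal (p i) r _ (r∉p i)) (↦-on v _ p-injective i)

  extendDep-r : (v : Fin n → Bool) (b : Bool) → extendDep v b r ≡ b
  extendDep-r v b = updateAt-updates r _

  extendDep∈depTeam : {h : (Fin n → Bool) → Bool} → Congruent _≗_ _≡_ h →
                      (v : Fin n → Bool) → extendDep v (h v) ∈T depTeam p r h
  extendDep∈depTeam {h} h-cong v =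
    ∈team⁺ (dep? p r h) {extendDep v (h v)}
      (trans (h-cong (extendDep-p v (h v))) (sym (extendDep-r v (h v))))

  depTeam-maximal : {h : (Fin n → Bool) → Bool} → Congruent _≗_ _≡_ h →
                    IsMaximal (Dep p r) (depTeam p r h)
  depTeam-maximal {h} h-cong = satisfies , maximal
    where
    satisfies : Dep p r (depTeam p r h)
    satisfies s s′ s∈ s′∈ same-p =
      trans (sym (∈team⁻ (dep? p r h) s∈))
            (trans (h-cong same-p) (∈team⁻ (dep? p r h) s′∈))
    maximal : ∀ U → Dep p r U → depTeam p r h ⊆T U → U ⊆T depTeam p r h
    maximal U dep-U h⊆U s s∈U =
      ∈team⁺ (dep? p r h) {s} (sym (trans s-r≡s′-r (extendDep-r v (h v))))
      where
      v : Fin n → Bool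
      v = s ∘ p
      s′ : Assignment m
      s′ = extendDep v (h v)
      s-r≡s′-r : s r ≡ s′ r
      s-r≡s′-r =
        dep-U s s′ s∈U (h⊆U s′ (extendDep∈depTeam h-cong v)) (sym ∘ extendDep-p v (h v))

  depTeam-injective : {h g : (Fin n → Bool) → Bool} →
                      Congruent _≗_ _≡_ h → Congruent _≗_ _≡_ g →
                      depTeam p r h ≐ depTeam p r g → ∀ v → h v ≡ g v
  depTeam-injective {h} {g} h-cong g-cong h≐g v = begin
    h v       ≡⟨ extendDep-r v (h v) ⟨
    s r       ≡⟨ ∈team⁻ (dep? p r g) {s} s∈g ⟨
    g (s ∘ p) ≡⟨ g-cong (extendDep-p v (h v)) ⟩
    g v       ∎
    where
    open ≡-Reasoning
    s : Assignment m
    s = extendDep v (h v)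
    s∈g : s ∈T depTeam p r g
    s∈g = trans (sym (h≐g s)) (extendDep∈depTeam h-cong v)

excl? : (p q : Fin n → Fin m) (h : (Fin n → Bool) → Bool) →
        Decidable (λ s → h (s ∘ p) ≡ true × h (s ∘ q) ≡ false)
excl? p q h s = (h (s ∘ p) ≟𝔹 true) ×-dec (h (s ∘ q) ≟𝔹 false)

exclTeam : (Fin n → Fin m) → (Fin n → Fin m) → ((Fin n → Bool) → Bool) → Team m
exclTeam p q h = team (excl? p q h)

module _ {p q : Fin n → Fin m}
         (p-injective : Injective _≡_ _≡_ p) (q-injective : Injective _≡_ _≡_ q)
         (p∉q : ∀ i j → p i ≢ q j) where

  extendExcl : (Fin n → Bool) → (Fin n → Bool) → Assignment m
  extendExcl v w = (const false [ p ↦ v ]) [ q ↦ w ]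

  extendExcl-p : (v w : Fin n → Bool) → extendExcl v w ∘ p ≗ v
  extendExcl-p v w i = trans (↦-off w _ (λ j → p∉q i j ∘ sym)) (↦-on v _ p-injective i)

  extendExcl-q : (v w : Fin n → Bool) → extendExcl v w ∘ q ≗ w
  extendExcl-q v w = ↦-on w _ q-injective

  extendExcl∈exclTeam : {h : (Fin n → Bool) → Bool} → Congruent _≗_ _≡_ h →
                        {v w : Fin n → Bool} → h v ≡ true → h w ≡ false →
                        extendExcl v w ∈T exclTeam p q h
  extendExcl∈exclTeam {h} h-cong {v} {w} hv≡true hw≡false =
    ∈team⁺ (excl? p q h) {extendExcl v w}
      ( trans (h-cong (extendExcl-p v w)) hv≡true
      , trans (h-cong (extendExcl-q v w)) hw≡false )

  extendExcl∈exclTeam⁻ : {h : (Fin n → Bool) → Bool} → Congruent _≗_ _≡_ h →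
                         {v w : Fin n → Bool} → extendExcl v w ∈T exclTeam p q h →
                         h v ≡ true × h w ≡ false
  extendExcl∈exclTeam⁻ {h} h-cong {v} {w} s∈
    with ∈team⁻ (excl? p q h) {extendExcl v w} s∈
  ... | hp≡true , hq≡false =
    trans (sym (h-cong (extendExcl-p v w))) hp≡true ,
    trans (sym (h-cong (extendExcl-q v w))) hq≡false

  exclTeam-maximal : {h : (Fin n → Bool) → Bool} → Congruent _≗_ _≡_ h →
                     {a c : Fin n → Bool} → h a ≡ true → h c ≡ false →
                     IsMaximal (Excl p q) (exclTeam p q h)
  exclTeam-maximal {h} h-cong {a} {c} ha≡true hc≡false = satisfies , maximal
    where
    satisfies : Excl p q (exclTeam p q h)
    satisfies s s′ s∈ s′∈ s-p≗s′-q = contradiction true≡false λ ()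
      where
      true≡false : true ≡ false
      true≡false = begin
        true       ≡⟨ proj₁ (∈team⁻ (excl? p q h) {s} s∈) ⟨
        h (s ∘ p)  ≡⟨ h-cong s-p≗s′-q ⟩
        h (s′ ∘ q) ≡⟨ proj₂ (∈team⁻ (excl? p q h) {s′} s′∈) ⟩
        false      ∎
        where open ≡-Reasoning
    maximal : ∀ U → Excl p q U → exclTeam p q h ⊆T U → U ⊆T exclTeam p q h
    maximal U excl-U h⊆U s s∈U =
      ∈team⁺ (excl? p q h) {s} (¬-not hp≢false , ¬-not hq≢true)
      where
      hp≢false : h (s ∘ p) ≢ false
      hp≢false hp≡false =
        excl-U s (extendExcl a (s ∘ p)) s∈U
          (h⊆U _ (extendExcl∈exclTeam h-cong ha≡true hp≡false))
          (sym ∘ extendExcl-q a (s ∘ p))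
      hq≢true : h (s ∘ q) ≢ true
      hq≢true hq≡true =
        excl-U (extendExcl (s ∘ q) c) s
          (h⊆U _ (extendExcl∈exclTeam h-cong hq≡true hc≡false)) s∈U
          (extendExcl-p (s ∘ q) c)

  exclTeam-injective : {h g : (Fin n → Bool) → Bool} →
                       Congruent _≗_ _≡_ h → Congruent _≗_ _≡_ g →
                       {a c : Fin n → Bool} → h a ≡ true → h c ≡ false →
                       exclTeam p q h ≐ exclTeam p q g → ∀ v → h v ≡ g v
  exclTeam-injective {h} {g} h-cong g-cong {a} {c} ha≡true hc≡false h≐g v =
    by-value (h v) refl
    where
    transfer : ∀ {v w} → h v ≡ true → h w ≡ false → g v ≡ true × g w ≡ false
    transfer {v} {w} hv hw = extendExcl∈exclTeam⁻ g-cong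
      (trans (sym (h≐g (extendExcl v w))) (extendExcl∈exclTeam h-cong hv hw))
    by-value : ∀ b → h v ≡ b → h v ≡ g v
    by-value true  hv≡true  = trans hv≡true (sym (proj₁ (transfer hv≡true hc≡false)))
    by-value false hv≡false = trans hv≡false (sym (proj₂ (transfer ha≡true hv≡false)))

DimAtLeast-Dep : {p : Fin n → Fin m} {r : Fin m} →
                 Injective _≡_ _≡_ p → (∀ i → p i ≢ r) →
                 DimAtLeast (Dep p r) (2 ^ 2 ^ n)
DimAtLeast-Dep {p = p} {r} p-injective r∉p =
  maximal⇒DimAtLeast (depTeam p r ∘ boolFun)
    (λ x → depTeam-maximal p-injective r∉p (boolFun-cong x))
    (λ x y Ux≐Uy → boolFun-injective
      (depTeam-injective p-injective r∉p (boolFun-cong x) (boolFun-cong y) Ux≐Uy))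

nonconstant⇒DimAtLeast-Excl :
  {p q : Fin n → Fin m} →
  Injective _≡_ _≡_ p → Injective _≡_ _≡_ q → (∀ i j → p i ≢ q j) →
  (f : Fin N → Fin (2 ^ 2 ^ n)) → Injective _≡_ _≡_ f →
  (∀ i → f i ≢ encode {2 ^ n} (const false)) →
  (∀ i → f i ≢ encode {2 ^ n} (const true)) →
  DimAtLeast (Excl p q) N
nonconstant⇒DimAtLeast-Excl {n} {N = N} {p = p} {q} p-injective q-injective p∉q
                            f f-injective f≢false f≢true =
  maximal⇒DimAtLeast (exclTeam p q ∘ h)
    (λ i → exclTeam-maximal p-injective q-injective p∉q (h-cong i)
             (proj₂ (true-point i)) (proj₂ (false-point i)))
    (λ i j Ui≐Uj → f-injective (boolFun-injective
      (exclTeam-injective p-injective q-injective p∉q (h-cong i) (h-cong j)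
        (proj₂ (true-point i)) (proj₂ (false-point i)) Ui≐Uj)))
  where
  h : Fin N → (Fin n → Bool) → Bool
  h = boolFun ∘ f
  h-cong : ∀ i → Congruent _≗_ _≡_ (h i)
  h-cong = boolFun-cong ∘ f
  true-point : ∀ i → ∃ λ a → h i a ≡ true
  true-point i = boolFun-nonconstant {n} false (f≢false i)
  false-point : ∀ i → ∃ λ c → h i c ≡ false
  false-point i = boolFun-nonconstant {n} true (f≢true i)

DimAtLeast-Excl : {p q : Fin n → Fin m} →
                  Injective _≡_ _≡_ p → Injective _≡_ _≡_ q →
                  (∀ i j → p i ≢ q j) →
                  DimAtLeast (Excl p q) (2 ^ 2 ^ n ∸ 2)
DimAtLeast-Excl {n} p-injective q-injective p∉q
  with f , f-injective , f≢false , f≢true ← avoid-two (encode-false≢encode-true {n}) =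
  nonconstant⇒DimAtLeast-Excl p-injective q-injective p∉q f f-injective f≢false f≢true

lemma3p14 : (k m : ℕ) → (p q : Fin (suc k) → Fin m)
    → Injective _≡_ _≡_ p → Injective _≡_ _≡_ q → (∀ i j → p i ≢ q j)
    → DimAtLeast (Dep p (q zero)) (2 ^ (2 ^ suc k))
      × DimAtLeast (Excl p q) (2 ^ (2 ^ suc k) ∸ 2)
lemma3p14 k m p q p-injective q-injective p∉q =
  DimAtLeast-Dep p-injective (λ i → p∉q i zero) ,
  DimAtLeast-Excl p-injective q-injective p∉q
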